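{- Fix integers $k\ge 2$ and $t\ge 1$. Then there is $n_0$ such that for all $n\ge n_0$: if $G$ is a subgraph of $T_k(kn)$ that contains no copy of $T_k(kt)$, then $e(G)\le t_k(kn)-\frac{n^2}{2}$.
   Context: $T_k(m)$ is the $k$-partite Turán graph: the complete $k$-partite graph on $m$ vertices with class sizes as equal as possible (so $T_k(kn)$ is the complete $k$-partite graph with all $k$ classes of size $n$), and $t_k(m)=e(T_k(m))$. -}

module Defs where

open import Data.Nat using (ℕ; _+_; _*_)
open import Data.Nat.ListAction using (sum)
open import Data.Bool using (Bool; true; false; if_then_else_)
open import Data.Fin using (Fin; toℕ; remQuot; _<?_; _≟_)
open import Data.List using (List; map; allFin)
open import Data.Product using (Σ; _×_; proj₁)
open import Data.Empty using (⊥-elim)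
open import Function.Definitions using (Injective)
open import Relation.Nullary using (¬_; does; yes; no)
open import Relation.Binary.PropositionalEquality as Eq using (_≡_; refl)

record Graph (N : ℕ) : Set where
  field
    adj    : Fin N → Fin N → Bool
    sym    : ∀ u v → adj u v ≡ adj v u
    irrefl : ∀ u → adj u u ≡ false
open Graph public

e : ∀ {N} → Graph N → ℕ
e {N} G = sum (map (λ u → sum (map (λ v →
            if does (u <? v) then (if adj G u v then 1 else 0) else 0)
            (allFin N))) (allFin N))

_⊆G_ : ∀ {N} → Graph N → Graph N → Set
G ⊆G H = ∀ u v → adj G u v ≡ true → adj H u v ≡ true

Contains : ∀ {N M} → Graph N → Graph M → Set
Contains {N} {M} G H =
  Σ (Fin M → Fin N) λ f → Injective _≡_ _≡_ f ×
    (∀ u v → adj H u v ≡ true → adj G (f u) (f v) ≡ true)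

cls : (k n : ℕ) → Fin (k * n) → Fin k
cls k n v = proj₁ (remQuot n v)

T : (k n : ℕ) → Graph (k * n)
adj (T k n) u v = if does (cls k n u ≟ cls k n v) then false else true
sym (T k n) u v with cls k n u ≟ cls k n v | cls k n v ≟ cls k n u
... | yes _ | yes _ = refl
... | no _  | no _  = refl
... | yes p | no q  = ⊥-elim (q (Eq.sym p))
... | no q  | yes p = ⊥-elim (q (Eq.sym p))
irrefl (T k n) u with cls k n u ≟ cls k n u
... | yes _ = refl
... | no q  = ⊥-elim (q refl)

-- Write combine i a for the a-th vertex of class i of T_k(kn); a transversal picks one vertex
-- from each class. If 2 e(G) + n² > 2 t_k(kn), fewer than n²/2 cross pairs are missing from G,
-- and each missing pair lies in only n^(k-2) of the n^k transversals, so at least half of the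
-- transversals span cliques of G. A density form of Erdős's theorem on complete k-partite
-- k-graphs then yields t vertices in each class all of whose transversals are cliques, that is,
-- a copy of T_k(kt). That theorem goes by induction on the number of classes: many tuples x of
-- the remaining classes have a large link {a | P (a ∷ x)}, hence many injective t-tuples inside
-- it, and averaging finds one t-tuple common to the links of a positive proportion of the x.
module Submission where

open import Defs renaming (sym to adj-sym)
import Algebra.Properties.Semiring.Sum as Sum
open import Data.Bool using (Bool; true; false; if_then_else_; _∧_; _∨_; not)
open import Data.Bool.Properties using (∧-assoc; ∧-zeroʳ; ∨-zeroʳ)
open import Data.Empty using (⊥-elim)
open import Data.Fin as Fin using (Fin; zero; suc; _↑ˡ_; _↑ʳ_; combine; remQuot)
open import Data.Fin.Properties as Finₚ using (_≟_; _<?_)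
import Data.List as List using (map; tabulate; allFin)
open import Data.List.Properties using (map-tabulate)
import Data.Nat.ListAction as List using (sum)
open import Data.Nat hiding (_≟_; _<?_)
open import Data.Nat.Properties hiding (_≟_; _<?_)
open import Data.Nat.Tactic.RingSolver using (solve-∀)
open import Data.Product using (Σ; ∃-syntax; _×_; _,_; proj₁; proj₂; uncurry)
open import Data.Vec.Functional using (Vector; []; _∷_; head; tail)
open import Function using (_∘_; _∘₂_)
open import Function.Definitions using (Injective)
open import Relation.Binary.Definitions using (tri<; tri≈; tri>)
open import Relation.Binary.PropositionalEquality
open import Relation.Nullary using (¬_; Dec; does; yes; no)
open import Relation.Nullary.Decidable using (dec-true; dec-false)

open Sum +-*-semiring using (sum; sum-syntax; sum-cong-≗; ∑-distrib-+; ∑-comm; *-distribˡ-sum)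

𝟙 : Bool → ℕ
𝟙 b = if b then 1 else 0

𝟙≤1 : ∀ b → 𝟙 b ≤ 1
𝟙≤1 true  = ≤-refl
𝟙≤1 false = z≤n

𝟙-∧ : ∀ b c → 𝟙 (b ∧ c) ≡ 𝟙 b * 𝟙 c
𝟙-∧ true  c = sym (+-identityʳ (𝟙 c))
𝟙-∧ false c = refl

𝟙-∨ : ∀ b c → 𝟙 (b ∨ c) ≤ 𝟙 b + 𝟙 c
𝟙-∨ true  c = s≤s z≤n
𝟙-∨ false c = ≤-refl

𝟙-pos : ∀ {b} → 0 < 𝟙 b → b ≡ true
𝟙-pos {true} _ = refl

𝟙-not≡0 : ∀ {b} → 𝟙 (not b) ≡ 0 → b ≡ true
𝟙-not≡0 {true} _ = refl

≡ᵇ0⇒≡0 : ∀ d → (d ≡ᵇ 0) ≡ true → d ≡ 0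
≡ᵇ0⇒≡0 zero _ = refl

∧-true : ∀ b c → b ∧ c ≡ true → b ≡ true × c ≡ true
∧-true true true _ = refl , refl

m*n>0⇒n>0 : ∀ m {n} → m * n > 0 → n > 0
m*n>0⇒n>0 m {suc n} _     = z<s
m*n>0⇒n>0 m {zero}  m*0>0 = ⊥-elim (<-irrefl refl (subst (0 <_) (*-zeroʳ m) m*0>0))

^-distribʳ-* : ∀ m n o → (m * n) ^ o ≡ m ^ o * n ^ o
^-distribʳ-* m n zero    = refl
^-distribʳ-* m n (suc o) = trans (cong (m * n *_) (^-distribʳ-* m n o)) (swap m n (m ^ o) (n ^ o))
  where
  swap : ∀ a b c d → a * b * (c * d) ≡ a * c * (b * d)
  swap = solve-∀

∑-const : ∀ N c → ∑[ a < N ] c ≡ N * c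
∑-const zero    c = refl
∑-const (suc N) c = cong (c +_) (∑-const N c)

∑-mono-≤ : ∀ {N} {f g : Vector ℕ N} → (∀ a → f a ≤ g a) → sum f ≤ sum g
∑-mono-≤ {zero}  f≤g = z≤n
∑-mono-≤ {suc N} f≤g = +-mono-≤ (f≤g zero) (∑-mono-≤ (f≤g ∘ suc))

∑-≤-bound : ∀ {N} c {f : Vector ℕ N} → (∀ a → f a ≤ c) → sum f ≤ N * c
∑-≤-bound {N} c f≤c = ≤-trans (∑-mono-≤ f≤c) (≤-reflexive (∑-const N c))

∑-*ˡ : ∀ {N} c (f : Vector ℕ N) → ∑[ a < N ] (c * f a) ≡ c * sum f
∑-*ˡ c f = sym (*-distribˡ-sum c f)

∑∑-*ˡ : ∀ {M N} c (f : Fin M → Fin N → ℕ) →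
  ∑[ a < M ] ∑[ b < N ] (c * f a b) ≡ c * ∑[ a < M ] ∑[ b < N ] f a b
∑∑-*ˡ c f = trans (sum-cong-≗ (λ a → ∑-*ˡ c (f a))) (∑-*ˡ c (λ a → sum (f a)))

∑-≡0 : ∀ {N} (f : Vector ℕ N) → sum f ≡ 0 → ∀ a → f a ≡ 0
∑-≡0 f ∑f≡0 zero    = m+n≡0⇒m≡0 (f zero) ∑f≡0
∑-≡0 f ∑f≡0 (suc a) = ∑-≡0 (f ∘ suc) (m+n≡0⇒n≡0 (f zero) ∑f≡0) a

∑-pos : ∀ {N} (f : Vector ℕ N) → 0 < sum f → ∃[ a ] 0 < f a
∑-pos {suc N} f 0<∑ with f zero in eq
... | suc _ = zero , subst (0 <_) (sym eq) z<s
... | zero  = let a , 0<fa = ∑-pos (f ∘ suc) 0<∑ in suc a , 0<fa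

∑-≤-some-term : ∀ {N} .{{_ : NonZero N}} (f : Vector ℕ N) → ∃[ a ] sum f ≤ N * f a
∑-≤-some-term {suc zero}    f = zero , ≤-refl
∑-≤-some-term {suc (suc N)} f with ∑-≤-some-term (f ∘ suc)
... | a , ∑≤ with f zero ≤? f (suc a)
...   | yes f₀≤fa = suc a , +-mono-≤ f₀≤fa ∑≤
...   | no  f₀≰fa = zero , +-monoʳ-≤ (f zero) (≤-trans ∑≤ (*-monoʳ-≤ (suc N) (<⇒≤ (≰⇒> f₀≰fa))))

∑-↑ : ∀ m p (f : Vector ℕ (m + p)) → sum f ≡ ∑[ a < m ] f (a ↑ˡ p) + ∑[ b < p ] f (m ↑ʳ b)
∑-↑ zero    p f = refl
∑-↑ (suc m) p f = trans (cong (f zero +_) (∑-↑ m p (f ∘ suc))) (sym (+-assoc (f zero) _ _))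

∑-combine : ∀ k n (f : Vector ℕ (k * n)) → sum f ≡ ∑[ i < k ] ∑[ a < n ] f (combine i a)
∑-combine zero    n f = refl
∑-combine (suc k) n f =
  trans (∑-↑ n (k * n) f) (cong (∑[ a < n ] f (a ↑ˡ k * n) +_) (∑-combine k n (f ∘ (n ↑ʳ_))))

∑-indicator-≟ : ∀ {N} (b : Fin N) → ∑[ a < N ] 𝟙 (does (a ≟ b)) ≡ 1
∑-indicator-≟ {suc N} zero    = cong suc (trans (∑-const N 0) (*-zeroʳ N))
∑-indicator-≟ {suc N} (suc b) = ∑-indicator-≟ b

listSum-tabulate : ∀ {N} (f : Fin N → ℕ) → List.sum (List.tabulate f) ≡ sum f
listSum-tabulate {zero}  f = refl
listSum-tabulate {suc N} f = cong (f zero +_) (listSum-tabulate (f ∘ suc))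

listSum-allFin : ∀ N (f : Fin N → ℕ) → List.sum (List.map f (List.allFin N)) ≡ sum f
listSum-allFin N f = trans (cong List.sum (map-tabulate (λ a → a) f)) (listSum-tabulate f)

module Tuples (n : ℕ) where

  ∑ᵗ : ∀ j → (Vector (Fin n) j → ℕ) → ℕ
  ∑ᵗ zero    f = f []
  ∑ᵗ (suc j) f = ∑[ a < n ] ∑ᵗ j (λ x → f (a ∷ x))

  ∑ᵗ-cong : ∀ j {f g : Vector (Fin n) j → ℕ} → (∀ x → f x ≡ g x) → ∑ᵗ j f ≡ ∑ᵗ j g
  ∑ᵗ-cong zero    f≡g = f≡g []
  ∑ᵗ-cong (suc j) f≡g = sum-cong-≗ (λ a → ∑ᵗ-cong j (λ x → f≡g (a ∷ x)))

  ∑ᵗ-mono-≤ : ∀ j {f g : Vector (Fin n) j → ℕ} → (∀ x → f x ≤ g x) → ∑ᵗ j f ≤ ∑ᵗ j g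
  ∑ᵗ-mono-≤ zero    f≤g = f≤g []
  ∑ᵗ-mono-≤ (suc j) f≤g = ∑-mono-≤ (λ a → ∑ᵗ-mono-≤ j (λ x → f≤g (a ∷ x)))

  ∑ᵗ-distrib-+ : ∀ j (f g : Vector (Fin n) j → ℕ) → ∑ᵗ j (λ x → f x + g x) ≡ ∑ᵗ j f + ∑ᵗ j g
  ∑ᵗ-distrib-+ zero    f g = refl
  ∑ᵗ-distrib-+ (suc j) f g =
    trans (sum-cong-≗ (λ a → ∑ᵗ-distrib-+ j (f ∘ (a ∷_)) (g ∘ (a ∷_))))
          (∑-distrib-+ (λ a → ∑ᵗ j (f ∘ (a ∷_))) (λ a → ∑ᵗ j (g ∘ (a ∷_))))

  ∑ᵗ-*ˡ : ∀ j c (f : Vector (Fin n) j → ℕ) → ∑ᵗ j (λ x → c * f x) ≡ c * ∑ᵗ j f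
  ∑ᵗ-*ˡ zero    c f = refl
  ∑ᵗ-*ˡ (suc j) c f =
    trans (sum-cong-≗ (λ a → ∑ᵗ-*ˡ j c (f ∘ (a ∷_)))) (∑-*ˡ c (λ a → ∑ᵗ j (f ∘ (a ∷_))))

  ∑ᵗ-const : ∀ j c → ∑ᵗ j (λ _ → c) ≡ n ^ j * c
  ∑ᵗ-const zero    c = sym (+-identityʳ c)
  ∑ᵗ-const (suc j) c = begin
    ∑[ a < n ] ∑ᵗ j (λ _ → c) ≡⟨ sum-cong-≗ {n} (λ _ → ∑ᵗ-const j c) ⟩
    ∑[ a < n ] (n ^ j * c)    ≡⟨ ∑-const n (n ^ j * c) ⟩
    n * (n ^ j * c)           ≡⟨ *-assoc n (n ^ j) c ⟨
    n ^ suc j * c             ∎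
    where open ≡-Reasoning

  ∑ᵗ-∑-comm : ∀ j {N} (f : Vector (Fin n) j → Fin N → ℕ) →
    ∑ᵗ j (λ x → ∑[ a < N ] f x a) ≡ ∑[ a < N ] ∑ᵗ j (λ x → f x a)
  ∑ᵗ-∑-comm zero    f = refl
  ∑ᵗ-∑-comm (suc j) f = trans (sum-cong-≗ (λ b → ∑ᵗ-∑-comm j (f ∘ (b ∷_))))
                              (∑-comm (λ b a → ∑ᵗ j (λ x → f (b ∷ x) a)))

  ∑ᵗ-comm : ∀ j m (f : Vector (Fin n) j → Vector (Fin n) m → ℕ) →
    ∑ᵗ j (λ x → ∑ᵗ m (f x)) ≡ ∑ᵗ m (λ y → ∑ᵗ j (λ x → f x y))
  ∑ᵗ-comm j zero    f = refl
  ∑ᵗ-comm j (suc m) f = trans (∑ᵗ-∑-comm j (λ x b → ∑ᵗ m (f x ∘ (b ∷_))))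
                              (sum-cong-≗ (λ b → ∑ᵗ-comm j m (λ x → f x ∘ (b ∷_))))

  ∑ᵗ-pos : ∀ j (f : Vector (Fin n) j → ℕ) → 0 < ∑ᵗ j f → ∃[ x ] 0 < f x
  ∑ᵗ-pos zero    f 0<f = [] , 0<f
  ∑ᵗ-pos (suc j) f 0<∑ =
    let a , 0<∑ₐ = ∑-pos (λ a → ∑ᵗ j (f ∘ (a ∷_))) 0<∑
        x , 0<fx = ∑ᵗ-pos j (f ∘ (a ∷_)) 0<∑ₐ
    in a ∷ x , 0<fx

  ∑ᵗ-≤-some-term : ∀ j .{{_ : NonZero n}} (f : Vector (Fin n) j → ℕ) →
    ∃[ x ] ∑ᵗ j f ≤ n ^ j * f x
  ∑ᵗ-≤-some-term zero    f = [] , ≤-reflexive (sym (+-identityʳ (f [])))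
  ∑ᵗ-≤-some-term (suc j) f =
    let a , ∑≤ = ∑-≤-some-term (λ a → n ^ j * f (a ∷ best a))
    in a ∷ best a , (begin
      ∑[ b < n ] ∑ᵗ j (f ∘ (b ∷_))        ≤⟨ ∑-mono-≤ (λ b → proj₂ (∑ᵗ-≤-some-term j (f ∘ (b ∷_)))) ⟩
      ∑[ b < n ] (n ^ j * f (b ∷ best b)) ≤⟨ ∑≤ ⟩
      n * (n ^ j * f (a ∷ best a))        ≡⟨ *-assoc n (n ^ j) _ ⟨
      n ^ suc j * f (a ∷ best a)          ∎)
    where
    open ≤-Reasoning
    best : Fin n → Vector (Fin n) j
    best b = proj₁ (∑ᵗ-≤-some-term j (f ∘ (b ∷_)))

  ∑ᵗ-coord : ∀ j (i : Fin (suc j)) (h : Fin n → ℕ) → ∑ᵗ (suc j) (λ x → h (x i)) ≡ n ^ j * sum h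
  ∑ᵗ-coord j       zero    h = trans (sum-cong-≗ (λ a → ∑ᵗ-const j (h a))) (∑-*ˡ (n ^ j) h)
  ∑ᵗ-coord (suc j) (suc i) h =
    trans (sum-cong-≗ {n} (λ _ → ∑ᵗ-coord j i h)) (trans (∑-const n _) (sym (*-assoc n (n ^ j) _)))

  ∑ᵗ-coord₂ : ∀ j {i i′ : Fin (2 + j)} → i Fin.< i′ → (g : Fin n → Fin n → ℕ) →
    ∑ᵗ (2 + j) (λ x → g (x i) (x i′)) ≡ n ^ j * ∑[ a < n ] ∑[ b < n ] g a b
  ∑ᵗ-coord₂ j       {zero}     {suc i′}   _ g =
    trans (sum-cong-≗ (λ a → ∑ᵗ-coord j i′ (g a))) (∑-*ˡ (n ^ j) (λ a → sum (g a)))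
  ∑ᵗ-coord₂ zero    {suc zero} {suc zero} (s≤s ()) g
  ∑ᵗ-coord₂ (suc j) {suc i}    {suc i′}   (s≤s i<i′) g =
    trans (sum-cong-≗ {n} (λ _ → ∑ᵗ-coord₂ j i<i′ g))
          (trans (∑-const n _) (sym (*-assoc n (n ^ j) _)))

  -- By recursion rather than λ i → B i (y i), so that a transversal of length 0 is [] on the nose.
  transversal : ∀ {t j} → Vector (Vector (Fin n) t) j → Vector (Fin t) j → Vector (Fin n) j
  transversal {j = zero}  B y = []
  transversal {j = suc j} B y = head B (head y) ∷ transversal (tail B) (tail y)

  transversal-apply : ∀ {t j} (B : Vector (Vector (Fin n) t) j) y i → transversal B y i ≡ B i (y i)
  transversal-apply B y zero    = refl
  transversal-apply B y (suc i) = transversal-apply (tail B) (tail y) i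

  CompleteBox : ∀ t j → (Vector (Fin n) j → Bool) → Set
  CompleteBox t j P = Σ (Vector (Vector (Fin n) t) j) λ B →
    (∀ i → Injective _≡_ _≡_ (B i)) × (∀ y → P (transversal B y) ≡ true)

  occurs : ∀ {m} → Fin n → Vector (Fin n) m → Bool
  occurs {zero}  a x = false
  occurs {suc m} a x = does (a ≟ head x) ∨ occurs a (tail x)

  distinctIn : (Fin n → Bool) → ∀ {m} → Vector (Fin n) m → Bool
  distinctIn A {zero}  x = true
  distinctIn A {suc m} x = A (head x) ∧ not (occurs (head x) (tail x)) ∧ distinctIn A (tail x)

  ∣_∣ : (Fin n → Bool) → ℕ
  ∣ A ∣ = ∑[ a < n ] 𝟙 (A a)

  ∣occurs∣≤ : ∀ {m} (x : Vector (Fin n) m) → ∣ (λ a → occurs a x) ∣ ≤ m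
  ∣occurs∣≤ {zero}  x = ≤-reflexive (trans (∑-const n 0) (*-zeroʳ n))
  ∣occurs∣≤ {suc m} x = begin
    ∑[ a < n ] 𝟙 (occurs a x)                        ≤⟨ ∑-mono-≤ (λ a → 𝟙-∨ (does (a ≟ x₀)) _) ⟩
    ∑[ a < n ] (𝟙 (does (a ≟ x₀)) + 𝟙 (occurs a x′)) ≡⟨ ∑-distrib-+ _ (λ a → 𝟙 (occurs a x′)) ⟩
    ∑[ a < n ] 𝟙 (does (a ≟ x₀)) + ∑[ a < n ] 𝟙 (occurs a x′)
      ≤⟨ +-mono-≤ (≤-reflexive (∑-indicator-≟ x₀)) (∣occurs∣≤ x′) ⟩
    suc m                                            ∎
    where
    open ≤-Reasoning
    x₀ : Fin n
    x₀ = head x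
    x′ : Vector (Fin n) m
    x′ = tail x

  ∣∣∸-≤-∣avoiding∣ : ∀ A {m} (x : Vector (Fin n) m) →
    ∣ A ∣ ∸ m ≤ ∣ (λ a → A a ∧ not (occurs a x)) ∣
  ∣∣∸-≤-∣avoiding∣ A {m} x = m≤n+o⇒m∸n≤o ∣ A ∣ m (begin
    ∣ A ∣                                              ≤⟨ ∑-mono-≤ (λ a → split (A a) (occurs a x)) ⟩
    ∑[ a < n ] (𝟙 (occurs a x) + 𝟙 (avoids a))        ≡⟨ ∑-distrib-+ (λ a → 𝟙 (occurs a x)) _ ⟩
    ∑[ a < n ] 𝟙 (occurs a x) + ∑[ a < n ] 𝟙 (avoids a) ≤⟨ +-monoˡ-≤ _ (∣occurs∣≤ x) ⟩
    m + ∑[ a < n ] 𝟙 (avoids a)                        ∎)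
    where
    open ≤-Reasoning
    avoids : Fin n → Bool
    avoids a = A a ∧ not (occurs a x)
    split : ∀ b c → 𝟙 b ≤ 𝟙 c + 𝟙 (b ∧ not c)
    split true  true  = s≤s z≤n
    split true  false = s≤s z≤n
    split false c     = z≤n

  ∑-distinctIn-≥ : ∀ A m → (∣ A ∣ ∸ m) ^ m ≤ ∑ᵗ m (𝟙 ∘ distinctIn A)
  ∑-distinctIn-≥ A zero    = ≤-refl
  ∑-distinctIn-≥ A (suc m) = begin
    (∣ A ∣ ∸ suc m) ^ suc m                       ≤⟨ ^-monoˡ-≤ (suc m) (∸-monoʳ-≤ ∣ A ∣ (n≤1+n m)) ⟩
    (∣ A ∣ ∸ m) * (∣ A ∣ ∸ m) ^ m                 ≤⟨ *-monoʳ-≤ (∣ A ∣ ∸ m) (∑-distinctIn-≥ A m) ⟩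
    (∣ A ∣ ∸ m) * ∑ᵗ m (𝟙 ∘ distinctIn A)         ≡⟨ ∑ᵗ-*ˡ m (∣ A ∣ ∸ m) (𝟙 ∘ distinctIn A) ⟨
    ∑ᵗ m (λ x → (∣ A ∣ ∸ m) * 𝟙 (distinctIn A x)) ≤⟨ ∑ᵗ-mono-≤ m (λ x →
                                                       *-monoˡ-≤ _ (∣∣∸-≤-∣avoiding∣ A x)) ⟩
    ∑ᵗ m (λ x → ∣ avoiding x ∣ * 𝟙 (distinctIn A x)) ≡⟨ ∑ᵗ-cong m extend ⟩
    ∑ᵗ m (λ x → ∑[ a < n ] 𝟙 (distinctIn A (a ∷ x)))
      ≡⟨ ∑ᵗ-∑-comm m (λ x a → 𝟙 (distinctIn A (a ∷ x))) ⟩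
    ∑ᵗ (suc m) (𝟙 ∘ distinctIn A)                 ∎
    where
    open ≤-Reasoning
    avoiding : Vector (Fin n) m → Fin n → Bool
    avoiding x a = A a ∧ not (occurs a x)
    extend : ∀ x → ∣ avoiding x ∣ * 𝟙 (distinctIn A x) ≡ ∑[ a < n ] 𝟙 (distinctIn A (a ∷ x))
    extend x = trans (*-comm ∣ avoiding x ∣ d) (trans (sym (∑-*ˡ d (𝟙 ∘ avoiding x)))
      (sum-cong-≗ (λ a → trans (*-comm d _) (trans (sym (𝟙-∧ (avoiding x a) _))
                                                   (cong 𝟙 (∧-assoc (A a) _ _))))))
      where
      d : ℕ
      d = 𝟙 (distinctIn A x)

  distinctIn-∷ : ∀ A {m} (x : Vector (Fin n) (suc m)) → distinctIn A x ≡ true →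
    A (head x) ≡ true × not (occurs (head x) (tail x)) ≡ true × distinctIn A (tail x) ≡ true
  distinctIn-∷ A x d = let A₀ , rest = ∧-true _ _ d in A₀ , ∧-true _ _ rest

  distinctIn⇒∈ : ∀ A {m} (x : Vector (Fin n) m) → distinctIn A x ≡ true → ∀ s → A (x s) ≡ true
  distinctIn⇒∈ A x d zero    = proj₁ (distinctIn-∷ A x d)
  distinctIn⇒∈ A x d (suc s) = distinctIn⇒∈ A (tail x) (proj₂ (proj₂ (distinctIn-∷ A x d))) s

  occurs-∈ : ∀ {m} (x : Vector (Fin n) m) s → occurs (x s) x ≡ true
  occurs-∈ x zero    = cong (_∨ occurs (x zero) (tail x)) (dec-true (x zero ≟ x zero) refl)
  occurs-∈ x (suc s) =
    trans (cong (does (x (suc s) ≟ x zero) ∨_) (occurs-∈ (tail x) s)) (∨-zeroʳ _)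

  ∉⇒≢ : ∀ {m} (y : Vector (Fin n) m) s {a} → not (occurs a y) ≡ true → a ≢ y s
  ∉⇒≢ y s a∉y refl with () ← trans (sym (cong not (occurs-∈ y s))) a∉y

  ∷-injective : ∀ {m} (x : Vector (Fin n) (suc m)) → not (occurs (head x) (tail x)) ≡ true →
    Injective _≡_ _≡_ (tail x) → Injective _≡_ _≡_ x
  ∷-injective x fresh tail-inj {zero}  {zero}   _  = refl
  ∷-injective x fresh tail-inj {zero}  {suc s′} eq = ⊥-elim (∉⇒≢ (tail x) s′ fresh eq)
  ∷-injective x fresh tail-inj {suc s} {zero}   eq = ⊥-elim (∉⇒≢ (tail x) s fresh (sym eq))
  ∷-injective x fresh tail-inj {suc s} {suc s′} eq = cong suc (tail-inj eq)

  distinctIn⇒injective : ∀ A {m} (x : Vector (Fin n) m) → distinctIn A x ≡ true →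
    Injective _≡_ _≡_ x
  distinctIn⇒injective A {zero}  x d {()}
  distinctIn⇒injective A {suc m} x d =
    let _ , fresh , rest = distinctIn-∷ A x d
    in ∷-injective x fresh (distinctIn⇒injective A (tail x) rest)

-- A (j+1)-partite family of density at least 1/D has a t-set in its first class whose common
-- link has density at least 1/nextDensity t D in the other j classes, provided 4Dt ≤ n.
nextDensity : ℕ → ℕ → ℕ
nextDensity t D = 2 * D * (4 * D) ^ t

boxThreshold : ℕ → ℕ → ℕ → ℕ
boxThreshold t zero    D = 0
boxThreshold t (suc j) D = 4 * D * t + boxThreshold t j (nextDensity t D)

module Box (n t : ℕ) .{{_ : NonZero n}} where

  open Tuples n

  module Step {j} (D : ℕ) (P : Vector (Fin n) (suc j) → Bool) where

    link : Vector (Fin n) j → Fin n → Bool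
    link x a = P (a ∷ x)

    rich : Vector (Fin n) j → Bool
    rich x = does (n ≤? 2 * D * ∣ link x ∣)

    ∣link∣≤n : ∀ x → ∣ link x ∣ ≤ n
    ∣link∣≤n x = ≤-trans (∑-≤-bound 1 (λ a → 𝟙≤1 (link x a))) (≤-reflexive (*-identityʳ n))

    markov : ∀ x → 2 * D * ∣ link x ∣ ≤ 𝟙 (rich x) * (2 * D * n) + n
    markov x = bound (n ≤? 2 * D * ∣ link x ∣)
      where
      bound : (r : Dec (n ≤ 2 * D * ∣ link x ∣)) → 2 * D * ∣ link x ∣ ≤ 𝟙 (does r) * (2 * D * n) + n
      bound (yes _)     = ≤-trans (*-monoʳ-≤ (2 * D) (∣link∣≤n x))
                          (≤-trans (m≤m+n _ n) (≤-reflexive (cong (_+ n) (sym (*-identityˡ _)))))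
      bound (no  ¬rich) = <⇒≤ (≰⇒> ¬rich)

    many-rich : n ^ suc j ≤ D * ∑ᵗ (suc j) (𝟙 ∘ P) → n ^ j ≤ 2 * D * ∑ᵗ j (𝟙 ∘ rich)
    many-rich dense = *-cancelˡ-≤ n (+-cancelʳ-≤ (n ^ suc j) _ _ (begin
      n ^ suc j + n ^ suc j                     ≡⟨ cong (n ^ suc j +_) (+-identityʳ _) ⟨
      2 * n ^ suc j                             ≤⟨ *-monoʳ-≤ 2 dense ⟩
      2 * (D * ∑ᵗ (suc j) (𝟙 ∘ P))              ≡⟨ *-assoc 2 D _ ⟨
      2 * D * ∑ᵗ (suc j) (𝟙 ∘ P)                ≡⟨ cong (2 * D *_) (∑ᵗ-∑-comm j (𝟙 ∘₂ link)) ⟨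
      2 * D * ∑ᵗ j (λ x → ∣ link x ∣)           ≡⟨ ∑ᵗ-*ˡ j (2 * D) (λ x → ∣ link x ∣) ⟨
      ∑ᵗ j (λ x → 2 * D * ∣ link x ∣)           ≤⟨ ∑ᵗ-mono-≤ j markov ⟩
      ∑ᵗ j (λ x → 𝟙 (rich x) * (2 * D * n) + n) ≡⟨ ∑ᵗ-distrib-+ j _ (λ _ → n) ⟩
      ∑ᵗ j (λ x → 𝟙 (rich x) * (2 * D * n)) + ∑ᵗ j (λ _ → n)
        ≡⟨ cong₂ _+_ (trans (∑ᵗ-cong j (λ x → *-comm (𝟙 (rich x)) _))
                            (∑ᵗ-*ˡ j (2 * D * n) (𝟙 ∘ rich)))
                     (trans (∑ᵗ-const j n) (*-comm (n ^ j) n)) ⟩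
      2 * D * n * ∑ᵗ j (𝟙 ∘ rich) + n ^ suc j   ≡⟨ cong (_+ n ^ suc j) (rearrange (2 * D) n _) ⟩
      n * (2 * D * ∑ᵗ j (𝟙 ∘ rich)) + n ^ suc j ∎))
      where
      open ≤-Reasoning
      rearrange : ∀ a b c → a * b * c ≡ b * (a * c)
      rearrange = solve-∀

    rich⇒many-tuples : 4 * D * t ≤ n → ∀ x →
      n ^ t * 𝟙 (rich x) ≤ (4 * D) ^ t * ∑ᵗ t (𝟙 ∘ distinctIn (link x))
    rich⇒many-tuples 4Dt≤n x = bound (n ≤? 2 * D * d)
      where
      open ≤-Reasoning
      d : ℕ
      d = ∣ link x ∣
      bound : (r : Dec (n ≤ 2 * D * d)) →
        n ^ t * 𝟙 (does r) ≤ (4 * D) ^ t * ∑ᵗ t (𝟙 ∘ distinctIn (link x))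
      bound (no _)      = ≤-trans (≤-reflexive (*-zeroʳ (n ^ t))) z≤n
      bound (yes n≤2Dd) = begin
        n ^ t * 1                                    ≡⟨ *-identityʳ _ ⟩
        n ^ t                                        ≤⟨ ^-monoˡ-≤ t n≤4D[d∸t] ⟩
        (4 * D * (d ∸ t)) ^ t                        ≡⟨ ^-distribʳ-* (4 * D) (d ∸ t) t ⟩
        (4 * D) ^ t * (d ∸ t) ^ t                    ≤⟨ *-monoʳ-≤ ((4 * D) ^ t)
                                                                   (∑-distinctIn-≥ (link x) t) ⟩
        (4 * D) ^ t * ∑ᵗ t (𝟙 ∘ distinctIn (link x)) ∎
        where
        double : ∀ D d → 2 * D * d + 2 * D * d ≡ 4 * D * d
        double = solve-∀
        n≤4D[d∸t] : n ≤ 4 * D * (d ∸ t)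
        n≤4D[d∸t] = begin
          n                                 ≡⟨ m+n∸m≡n n n ⟨
          n + n ∸ n                         ≤⟨ ∸-mono (+-mono-≤ n≤2Dd n≤2Dd) 4Dt≤n ⟩
          2 * D * d + 2 * D * d ∸ 4 * D * t ≡⟨ cong (_∸ 4 * D * t) (double D d) ⟩
          4 * D * d ∸ 4 * D * t             ≡⟨ *-distribˡ-∸ (4 * D) d t ⟨
          4 * D * (d ∸ t)                   ∎

    common-tuple : 4 * D * t ≤ n → n ^ suc j ≤ D * ∑ᵗ (suc j) (𝟙 ∘ P) →
      ∃[ τ ] n ^ j ≤ nextDensity t D * ∑ᵗ j (λ x → 𝟙 (distinctIn (link x) τ))
    common-tuple 4Dt≤n dense = best , *-cancelˡ-≤ (n ^ t) {{m^n≢0 n t}} (begin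
      n ^ t * n ^ j                               ≤⟨ *-monoʳ-≤ (n ^ t) (many-rich dense) ⟩
      n ^ t * (2 * D * ∑ᵗ j (𝟙 ∘ rich))           ≡⟨ swap (n ^ t) (2 * D) _ ⟩
      2 * D * (n ^ t * ∑ᵗ j (𝟙 ∘ rich))           ≡⟨ cong (2 * D *_) (∑ᵗ-*ˡ j (n ^ t) (𝟙 ∘ rich)) ⟨
      2 * D * ∑ᵗ j (λ x → n ^ t * 𝟙 (rich x))
        ≤⟨ *-monoʳ-≤ (2 * D) (∑ᵗ-mono-≤ j (rich⇒many-tuples 4Dt≤n)) ⟩
      2 * D * ∑ᵗ j (λ x → (4 * D) ^ t * tuples x) ≡⟨ cong (2 * D *_) (∑ᵗ-*ˡ j ((4 * D) ^ t) tuples) ⟩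
      2 * D * ((4 * D) ^ t * ∑ᵗ j tuples)         ≡⟨ *-assoc (2 * D) _ _ ⟨
      nextDensity t D * ∑ᵗ j tuples               ≡⟨ cong (nextDensity t D *_) (∑ᵗ-comm j t _) ⟩
      nextDensity t D * ∑ᵗ t Q                    ≤⟨ *-monoʳ-≤ (nextDensity t D) best-maximal ⟩
      nextDensity t D * (n ^ t * Q best)          ≡⟨ swap (nextDensity t D) (n ^ t) (Q best) ⟩
      n ^ t * (nextDensity t D * Q best)          ∎)
      where
      open ≤-Reasoning
      tuples : Vector (Fin n) j → ℕ
      tuples x = ∑ᵗ t (𝟙 ∘ distinctIn (link x))
      Q : Vector (Fin n) t → ℕ
      Q τ = ∑ᵗ j (λ x → 𝟙 (distinctIn (link x) τ))
      best : Vector (Fin n) t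
      best = proj₁ (∑ᵗ-≤-some-term t Q)
      best-maximal : ∑ᵗ t Q ≤ n ^ t * Q best
      best-maximal = proj₂ (∑ᵗ-≤-some-term t Q)
      swap : ∀ a b c → a * (b * c) ≡ b * (a * c)
      swap = solve-∀

  complete-box : ∀ j D → boxThreshold t j D ≤ n → (P : Vector (Fin n) j → Bool) →
    n ^ j ≤ D * ∑ᵗ j (𝟙 ∘ P) → CompleteBox t j P
  complete-box zero    D _   P dense = [] , (λ ()) , (λ _ → 𝟙-pos (m*n>0⇒n>0 D dense))
  complete-box (suc j) D thr P dense = τ ∷ B , injective , λ y →
    distinctIn⇒∈ (link (transversal B (tail y))) τ (B-in-links (tail y)) (head y)
    where
    open Step D P
    4Dt≤n : 4 * D * t ≤ n
    4Dt≤n = ≤-trans (m≤m+n _ _) thr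
    τ : Vector (Fin n) t
    τ = proj₁ (common-tuple 4Dt≤n dense)
    dense-links : n ^ j ≤ nextDensity t D * ∑ᵗ j (λ x → 𝟙 (distinctIn (link x) τ))
    dense-links = proj₂ (common-tuple 4Dt≤n dense)
    box : CompleteBox t j (λ x → distinctIn (link x) τ)
    box = complete-box j (nextDensity t D) (≤-trans (m≤n+m _ _) thr) _ dense-links
    B : Vector (Vector (Fin n) t) j
    B = proj₁ box
    B-in-links : ∀ y → distinctIn (link (transversal B y)) τ ≡ true
    B-in-links = proj₂ (proj₂ box)
    τ-injective : Injective _≡_ _≡_ τ
    τ-injective =
      let x , 0<𝟙 = ∑ᵗ-pos j _ (m*n>0⇒n>0 (nextDensity t D) (<-≤-trans (m^n>0 n j) dense-links))
      in distinctIn⇒injective (link x) τ (𝟙-pos 0<𝟙)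
    injective : ∀ i → Injective _≡_ _≡_ ((τ ∷ B) i)
    injective zero    = τ-injective
    injective (suc i) = proj₁ (proj₂ box) i

edgeTerm : ∀ {N} → Graph N → Fin N → Fin N → ℕ
edgeTerm H u v = if does (u <? v) then 𝟙 (adj H u v) else 0

e-as-∑ : ∀ {N} (H : Graph N) → e H ≡ ∑[ u < N ] ∑[ v < N ] edgeTerm H u v
e-as-∑ {N} H = trans (listSum-allFin N _) (sum-cong-≗ (λ u → listSum-allFin N (edgeTerm H u)))

missingTerm : ∀ {N} → Graph N → Graph N → Fin N → Fin N → ℕ
missingTerm G H u v = 𝟙 (does (u <? v) ∧ adj H u v ∧ not (adj G u v))

missing : ∀ {N} → Graph N → Graph N → ℕ
missing {N} G H = ∑[ u < N ] ∑[ v < N ] missingTerm G H u v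

e-⊆G : ∀ {N} {G H : Graph N} → G ⊆G H → e H ≡ e G + missing G H
e-⊆G {N} {G} {H} G⊆H = begin
  e H
    ≡⟨ e-as-∑ H ⟩
  ∑[ u < N ] ∑[ v < N ] edgeTerm H u v
    ≡⟨ sum-cong-≗ (λ u → sum-cong-≗ (λ v → split (does (u <? v)) (G⊆H u v))) ⟩
  ∑[ u < N ] ∑[ v < N ] (edgeTerm G u v + missingTerm G H u v)
    ≡⟨ sum-cong-≗ (λ u → ∑-distrib-+ (edgeTerm G u) (missingTerm G H u)) ⟩
  ∑[ u < N ] (sum (edgeTerm G u) + sum (missingTerm G H u))
    ≡⟨ ∑-distrib-+ (sum ∘ edgeTerm G) (sum ∘ missingTerm G H) ⟩
  ∑[ u < N ] ∑[ v < N ] edgeTerm G u v + missing G H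
    ≡⟨ cong (_+ missing G H) (e-as-∑ G) ⟨
  e G + missing G H
    ∎
  where
  open ≡-Reasoning
  split : ∀ o {g h} → (g ≡ true → h ≡ true) →
    (if o then 𝟙 h else 0) ≡ (if o then 𝟙 g else 0) + 𝟙 (o ∧ h ∧ not g)
  split false                   _   = refl
  split true  {true}            g⇒h rewrite g⇒h refl = refl
  split true  {false} {true}    _   = refl
  split true  {false} {false}   _   = refl

adj-T-combine : ∀ {k n} (i : Fin k) (a : Fin n) i′ b →
  adj (T k n) (combine i a) (combine i′ b) ≡ not (does (i ≟ i′))
adj-T-combine {k} {n} i a i′ b =
  trans (cong₂ (λ c c′ → if does (c ≟ c′) then false else true)
               (cong proj₁ (Finₚ.remQuot-combine {k} {n} i a))
               (cong proj₁ (Finₚ.remQuot-combine {k} {n} i′ b)))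
        (if-not (does (i ≟ i′)))
  where
  if-not : ∀ b → (if b then false else true) ≡ not b
  if-not true  = refl
  if-not false = refl

adj-T⇒cls≢ : ∀ {k n} (u v : Fin (k * n)) → adj (T k n) u v ≡ true → cls k n u ≢ cls k n v
adj-T⇒cls≢ {k} {n} u v uv∈T cu≡cv with cls k n u ≟ cls k n v
... | yes _    with () ← uv∈T
... | no cu≢cv = cu≢cv cu≡cv

combine-<-T : ∀ {k n} (i : Fin k) (a : Fin n) i′ b →
  does (combine i a <? combine i′ b) ∧ adj (T k n) (combine i a) (combine i′ b) ≡ does (i <? i′)
combine-<-T i a i′ b rewrite adj-T-combine i a i′ b with Finₚ.<-cmp i i′
... | tri< i<i′ i≢i′ _ rewrite dec-true (combine i a <? combine i′ b) (Finₚ.combine-monoˡ-< a b i<i′)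
                             | dec-false (i ≟ i′) i≢i′ | dec-true (i <? i′) i<i′ = refl
... | tri≈ _ refl _   rewrite dec-true (i ≟ i) refl | dec-false (i <? i) (Finₚ.<-irrefl refl) =
  ∧-zeroʳ (does (combine i a <? combine i b))
... | tri> i≮i′ _ i′<i rewrite dec-false (combine i a <? combine i′ b)
                                 (Finₚ.<-asym (Finₚ.combine-monoˡ-< b a i′<i))
                             | dec-false (i <? i′) i≮i′ = refl

module CrossCliques (k′ n : ℕ) (G : Graph (suc (suc k′) * n)) where

  open Tuples n

  k : ℕ
  k = suc (suc k′)

  nonEdge : Fin k → Fin k → Fin n → Fin n → ℕ
  nonEdge i i′ a b = 𝟙 (not (adj G (combine i a) (combine i′ b)))

  missingBetween : Fin k → Fin k → ℕ
  missingBetween i i′ = ∑[ a < n ] ∑[ b < n ] nonEdge i i′ a b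

  missingAcross : ℕ
  missingAcross = ∑[ i < k ] ∑[ i′ < k ] (𝟙 (does (i <? i′)) * missingBetween i i′)

  missing-T≡missingAcross : missing G (T k n) ≡ missingAcross
  missing-T≡missingAcross = begin
    missing G (T k n)
      ≡⟨ ∑-combine k n (sum ∘ M) ⟩
    ∑[ i < k ] ∑[ a < n ] ∑[ v < k * n ] M (combine i a) v
      ≡⟨ sum-cong-≗ {k} (λ i → sum-cong-≗ {n} (λ a → ∑-combine k n (M (combine i a)))) ⟩
    ∑[ i < k ] ∑[ a < n ] ∑[ i′ < k ] ∑[ b < n ] M (combine i a) (combine i′ b)
      ≡⟨ sum-cong-≗ (λ i → sum-cong-≗ (λ a → sum-cong-≗ (λ i′ → sum-cong-≗ (λ b → term i a i′ b)))) ⟩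
    ∑[ i < k ] ∑[ a < n ] ∑[ i′ < k ] ∑[ b < n ] (𝟙 (does (i <? i′)) * nonEdge i i′ a b)
      ≡⟨ sum-cong-≗ (λ i → ∑-comm (λ a i′ → ∑[ b < n ] (𝟙 (does (i <? i′)) * nonEdge i i′ a b))) ⟩
    ∑[ i < k ] ∑[ i′ < k ] ∑[ a < n ] ∑[ b < n ] (𝟙 (does (i <? i′)) * nonEdge i i′ a b)
      ≡⟨ sum-cong-≗ (λ i → sum-cong-≗ (λ i′ → ∑∑-*ˡ (𝟙 (does (i <? i′))) (nonEdge i i′))) ⟩
    missingAcross ∎
    where
    open ≡-Reasoning
    M : Fin (k * n) → Fin (k * n) → ℕ
    M = missingTerm G (T k n)
    term : ∀ i a i′ b → M (combine i a) (combine i′ b) ≡ 𝟙 (does (i <? i′)) * nonEdge i i′ a b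
    term i a i′ b = begin
      𝟙 (o ∧ adj (T k n) (combine i a) (combine i′ b) ∧ not g)   ≡⟨ cong 𝟙 (∧-assoc o _ _) ⟨
      𝟙 ((o ∧ adj (T k n) (combine i a) (combine i′ b)) ∧ not g) ≡⟨ cong (λ c → 𝟙 (c ∧ not g))
                                                                        (combine-<-T i a i′ b) ⟩
      𝟙 (does (i <? i′) ∧ not g)                                 ≡⟨ 𝟙-∧ (does (i <? i′)) (not g) ⟩
      𝟙 (does (i <? i′)) * nonEdge i i′ a b                      ∎
      where
      o g : Bool
      o = does (combine i a <? combine i′ b)
      g = adj G (combine i a) (combine i′ b)

  defect : Vector (Fin n) k → ℕ
  defect x = ∑[ i < k ] ∑[ i′ < k ] (𝟙 (does (i <? i′)) * nonEdge i i′ (x i) (x i′))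

  ∑-defect : ∑ᵗ k defect ≡ n ^ k′ * missingAcross
  ∑-defect = begin
    ∑ᵗ k defect
      ≡⟨ ∑ᵗ-∑-comm k (λ x i → ∑[ i′ < k ] term i i′ x) ⟩
    ∑[ i < k ] ∑ᵗ k (λ x → ∑[ i′ < k ] term i i′ x)
      ≡⟨ sum-cong-≗ (λ i → ∑ᵗ-∑-comm k (λ x i′ → term i i′ x)) ⟩
    ∑[ i < k ] ∑[ i′ < k ] ∑ᵗ k (term i i′)
      ≡⟨ sum-cong-≗ {k} (λ i → sum-cong-≗ {k} (λ i′ →
           trans (∑ᵗ-*ˡ k (𝟙 (does (i <? i′))) (λ x → nonEdge i i′ (x i) (x i′)))
                 (pair i i′ (i <? i′)))) ⟩
    ∑[ i < k ] ∑[ i′ < k ] (n ^ k′ * (𝟙 (does (i <? i′)) * missingBetween i i′))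
      ≡⟨ ∑∑-*ˡ (n ^ k′) (λ i i′ → 𝟙 (does (i <? i′)) * missingBetween i i′) ⟩
    n ^ k′ * missingAcross ∎
    where
    open ≡-Reasoning
    term : Fin k → Fin k → Vector (Fin n) k → ℕ
    term i i′ x = 𝟙 (does (i <? i′)) * nonEdge i i′ (x i) (x i′)
    pair : ∀ i i′ (r : Dec (i Fin.< i′)) → 𝟙 (does r) * ∑ᵗ k (λ x → nonEdge i i′ (x i) (x i′))
                                          ≡ n ^ k′ * (𝟙 (does r) * missingBetween i i′)
    pair i i′ (yes i<i′) = trans (*-identityˡ _) (trans (∑ᵗ-coord₂ k′ i<i′ (nonEdge i i′))
                                                        (cong (n ^ k′ *_) (sym (*-identityˡ _))))
    pair i i′ (no _)     = sym (*-zeroʳ (n ^ k′))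

  isCrossClique : Vector (Fin n) k → Bool
  isCrossClique x = defect x ≡ᵇ 0

  many-cross-cliques : 2 * missingAcross ≤ n * n → n ^ k ≤ 2 * ∑ᵗ k (𝟙 ∘ isCrossClique)
  many-cross-cliques 2M≤n² = +-cancelʳ-≤ (n ^ k) (n ^ k) (2 * C) (begin
    n ^ k + n ^ k                                   ≡⟨ double (n ^ k) ⟩
    2 * (n ^ k * 1)                                 ≡⟨ cong (2 *_) (∑ᵗ-const k 1) ⟨
    2 * ∑ᵗ k (λ _ → 1)                              ≤⟨ *-monoʳ-≤ 2 (∑ᵗ-mono-≤ k (λ x →
                                                         clique-or-defect (defect x))) ⟩
    2 * ∑ᵗ k (λ x → 𝟙 (isCrossClique x) + defect x) ≡⟨ cong (2 *_)
                                                         (∑ᵗ-distrib-+ k (𝟙 ∘ isCrossClique) defect) ⟩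
    2 * (C + ∑ᵗ k defect)                           ≡⟨ cong (λ d → 2 * (C + d)) ∑-defect ⟩
    2 * (C + n ^ k′ * missingAcross)                ≡⟨ distribute C (n ^ k′) missingAcross ⟩
    2 * C + n ^ k′ * (2 * missingAcross)            ≤⟨ +-monoʳ-≤ (2 * C) (*-monoʳ-≤ (n ^ k′) 2M≤n²) ⟩
    2 * C + n ^ k′ * (n * n)                        ≡⟨ cong (2 * C +_) (regroup (n ^ k′) n) ⟩
    2 * C + n ^ k                                   ∎)
    where
    open ≤-Reasoning
    C : ℕ
    C = ∑ᵗ k (𝟙 ∘ isCrossClique)
    clique-or-defect : ∀ d → 1 ≤ 𝟙 (d ≡ᵇ 0) + d
    clique-or-defect zero    = ≤-refl
    clique-or-defect (suc d) = s≤s z≤n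
    double : ∀ a → a + a ≡ 2 * (a * 1)
    double = solve-∀
    distribute : ∀ c a m → 2 * (c + a * m) ≡ 2 * c + a * (2 * m)
    distribute = solve-∀
    regroup : ∀ a n → a * (n * n) ≡ n * (n * a)
    regroup = solve-∀

  cross-clique-ordered : ∀ x → isCrossClique x ≡ true → ∀ {i i′} → i Fin.< i′ →
    adj G (combine i (x i)) (combine i′ (x i′)) ≡ true
  cross-clique-ordered x clique {i} {i′} i<i′ =
    𝟙-not≡0 (m+n≡0⇒m≡0 _ (subst (λ b → 𝟙 b * nonEdge i i′ (x i) (x i′) ≡ 0)
                                 (dec-true (i <? i′) i<i′) term≡0))
    where
    term : Fin k → Fin k → ℕ
    term i i′ = 𝟙 (does (i <? i′)) * nonEdge i i′ (x i) (x i′)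
    term≡0 : term i i′ ≡ 0
    term≡0 = ∑-≡0 (term i) (∑-≡0 (sum ∘ term) (≡ᵇ0⇒≡0 (defect x) clique) i) i′

  cross-clique-adj : ∀ x → isCrossClique x ≡ true → ∀ {i i′} → i ≢ i′ →
    adj G (combine i (x i)) (combine i′ (x i′)) ≡ true
  cross-clique-adj x clique {i} {i′} i≢i′ with Finₚ.<-cmp i i′
  ... | tri< i<i′ _ _ = cross-clique-ordered x clique i<i′
  ... | tri≈ _ i≡i′ _ = ⊥-elim (i≢i′ i≡i′)
  ... | tri> _ _ i′<i = trans (adj-sym G _ _) (cross-clique-ordered x clique i′<i)

  cross-box⇒copy : ∀ {t} → CompleteBox t k isCrossClique → Contains G (T k t)
  cross-box⇒copy {t} (B , B-injective , B-cliques) =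
    embed , (λ {w} {w′} → embed-injective w w′) ,
    λ w w′ ww′∈T → embed′-adj (adj-T⇒cls≢ {k} {t} w w′ ww′∈T)
    where
    embed′ : Fin k → Fin t → Fin (k * n)
    embed′ i s = combine i (B i s)

    embed : Fin (k * t) → Fin (k * n)
    embed w = uncurry embed′ (remQuot t w)

    embed′-injective : ∀ p p′ → uncurry embed′ p ≡ uncurry embed′ p′ → p ≡ p′
    embed′-injective (i , s) (i′ , s′) eq
      with refl ← Finₚ.combine-injectiveˡ i (B i s) i′ (B i′ s′) eq =
      cong (i ,_) (B-injective i (Finₚ.combine-injectiveʳ i (B i s) i (B i s′) eq))

    embed-injective : ∀ w w′ → embed w ≡ embed w′ → w ≡ w′
    embed-injective w w′ eq = begin
      w                                  ≡⟨ Finₚ.combine-remQuot {k} t w ⟨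
      uncurry combine (remQuot {k} t w)  ≡⟨ cong (uncurry combine)
                                                 (embed′-injective (remQuot t w) (remQuot t w′) eq) ⟩
      uncurry combine (remQuot {k} t w′) ≡⟨ Finₚ.combine-remQuot {k} t w′ ⟩
      w′                                 ∎
      where open ≡-Reasoning

    embed′-adj : ∀ {i s i′ s′} → i ≢ i′ → adj G (embed′ i s) (embed′ i′ s′) ≡ true
    embed′-adj {i} {s} {i′} {s′} i≢i′ =
      subst₂ (λ a b → adj G (combine i a) (combine i′ b) ≡ true) x-at-i x-at-i′
             (cross-clique-adj x (B-cliques y) i≢i′)
      where
      y : Vector (Fin t) k
      y l = if does (l ≟ i) then s else s′
      x : Vector (Fin n) k
      x = transversal B y
      x-at-i : x i ≡ B i s
      x-at-i = trans (transversal-apply B y i)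
                     (cong (λ b → B i (if b then s else s′)) (dec-true (i ≟ i) refl))
      x-at-i′ : x i′ ≡ B i′ s′
      x-at-i′ = trans (transversal-apply B y i′)
                      (cong (λ b → B i′ (if b then s else s′)) (dec-false (i′ ≟ i) (i≢i′ ∘ sym)))

  few-missing-across : G ⊆G T k n → 2 * e (T k n) < 2 * e G + n * n → 2 * missingAcross ≤ n * n
  few-missing-across G⊆T near = <⇒≤ (+-cancelˡ-< (2 * e G) (2 * missingAcross) (n * n) (begin-strict
    2 * e G + 2 * missingAcross   ≡⟨ *-distribˡ-+ 2 (e G) missingAcross ⟨
    2 * (e G + missingAcross)     ≡⟨ cong (λ m → 2 * (e G + m)) missing-T≡missingAcross ⟨
    2 * (e G + missing G (T k n)) ≡⟨ cong (2 *_) (e-⊆G {G = G} {H = T k n} G⊆T) ⟨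
    2 * e (T k n)                 <⟨ near ⟩
    2 * e G + n * n               ∎))
    where open ≤-Reasoning

  few-missing⇒copy : ∀ t .{{_ : NonZero n}} → boxThreshold t k 2 ≤ n →
    2 * missingAcross ≤ n * n → Contains G (T k t)
  few-missing⇒copy t thr≤n 2M≤n² =
    cross-box⇒copy (Box.complete-box n t k 2 thr≤n isCrossClique (many-cross-cliques 2M≤n²))

proposition12 : (k t : ℕ) → 2 ≤ k → 1 ≤ t →
    Σ ℕ λ n₀ → (n : ℕ) → n₀ ≤ n →
      (G : Graph (k * n)) → G ⊆G T k n → ¬ Contains G (T k t) →
      2 * e G + n * n ≤ 2 * e (T k n)
proposition12 (suc (suc k′)) t@(suc _) _ _ = boxThreshold t (suc (suc k′)) 2 , λ n thr≤n G G⊆T G∌T →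
  let open CrossCliques k′ n G
      instance
        n≢0 : NonZero n
        n≢0 = >-nonZero (≤-trans (s≤s z≤n) (≤-trans (m≤m+n (4 * 2 * t) _) thr≤n))
  in ≮⇒≥ (λ near → G∌T (few-missing⇒copy t thr≤n (few-missing-across G⊆T near)))
proposition12 (suc (suc _)) zero _ ()
proposition12 (suc zero)    _    (s≤s ()) _
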